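{- Let $\mathcal{A}$ be a primitive integral Apollonian circle packing and let $a,b$ be the curvatures of two tangent circles of $\mathcal{A}$. Then $a+b\not\equiv 3,6,7 \pmod 8$. In particular, if $\mathcal{A}$ has type $(8,k)$ (for $k\in\{7,11\}$) and $a,b$ are both odd, then one of $a,b$ is $\equiv 3\pmod 8$ and the other is $\equiv 7 \pmod 8$.
   Context: Apollonian packings: start from four mutually tangent circles in the plane (lines allowed) and repeatedly add, for every triple of mutually tangent circles present, the two circles tangent to all three. Curvatures are signed ($1/\text{radius}$; lines $0$; a circle containing the others in its interior is negative). The curvatures $(a,b,c,d)$ of any four mutually tangent circles of the packing satisfy $(a+b+c+d)^2=2(a^2+b^2+c^2+d^2)$. Primitive integral: all curvatures are integers with overall gcd $1$. The packing has type $(8,7)$ if its set of curvature residues mod $24$ is $\{3,6,7,10,15,18,19,22\}$ and type $(8,11)$ if it is $\{2,3,6,11,14,15,18,23\}$. -}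

module Defs where

open import Data.Nat using (ℕ)
open import Data.Integer using (ℤ; +_; _+_; _-_; _*_; _<_; _%ℕ_)
open import Data.Integer.Divisibility using (_∣_)
open import Data.Fin using (Fin; _≟_)
open import Data.Fin.Patterns using (0F; 1F; 2F; 3F)
open import Data.Product using (Σ; ∃; _×_)
open import Data.List using (List; _∷_; [])
open import Data.List.Membership.Propositional using (_∈_)
open import Relation.Nullary using (yes; no; ¬_)
open import Relation.Binary.PropositionalEquality using (_≡_)
open import Function.Bundles using (_⇔_)

-- An (ordered) quadruple of signed curvatures of four mutually tangent circles.
Quad : Set
Quad = Fin 4 → ℤ

total : Quad → ℤ
total q = q 0F + q 1F + q 2F + q 3F

sumSq : Quad → ℤ
sumSq q = q 0F * q 0F + q 1F * q 1F + q 2F * q 2F + q 3F * q 3F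

Descartes : Quad → Set
Descartes q = total q * total q ≡ + 2 * sumSq q

-- Geometric sign convention for a genuine configuration of four mutually
-- tangent circles with disjoint interiors: at most one negative curvature
-- and positive total curvature.
AtMostOneNegative : Quad → Set
AtMostOneNegative q = (i j : Fin 4) → q i < + 0 → q j < + 0 → i ≡ j

Oriented : Quad → Set
Oriented q = AtMostOneNegative q × (+ 0 < total q)

-- Replacing circle i by the other circle tangent to the remaining three:
-- d_i' = 2 (sum of the other three) - d_i.
move : Fin 4 → Quad → Quad
move i q j with j ≟ i
... | yes _ = + 2 * (total q - q i) - q i
... | no  _ = q j

-- Descartes quadruples of the packing generated by a root quadruple
-- (orbit under the Apollonian group).
data _⇝_ (r : Quad) : Quad → Set where
  here : r ⇝ r
  step : ∀ {q} (i : Fin 4) → r ⇝ q → r ⇝ move i q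

IsCurvature : Quad → ℤ → Set
IsCurvature r c = ∃ λ q → r ⇝ q × ∃ λ i → q i ≡ c

TangentPair : Quad → ℤ → ℤ → Set
TangentPair r a b =
  ∃ λ q → r ⇝ q × ∃ λ i → ∃ λ j → ¬ (i ≡ j) × q i ≡ a × q j ≡ b

Primitive : Quad → Set
Primitive r = (g : ℤ) → ((c : ℤ) → IsCurvature r c → g ∣ c) → g ∣ + 1

HasResidues24 : Quad → List ℕ → Set
HasResidues24 r S = (n : ℕ) → (∃ λ c → IsCurvature r c × c %ℕ 24 ≡ n) ⇔ (n ∈ S)

type87 : List ℕ
type87 = 3 ∷ 6 ∷ 7 ∷ 10 ∷ 15 ∷ 18 ∷ 19 ∷ 22 ∷ []

type811 : List ℕ
type811 = 2 ∷ 3 ∷ 6 ∷ 11 ∷ 14 ∷ 15 ∷ 18 ∷ 23 ∷ []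

PrimitiveIntegralPacking : Quad → Set
PrimitiveIntegralPacking r = Descartes r × Oriented r × Primitive r

module Submission where

-- Let a, b be tangent and c, d complete a Descartes quadruple (a, b, c, d).  Then
-- q = (a + b + c - d)/2 satisfies q² = ab + c(a + b), so N = a + b divides a² + q².
-- An N ≡ 3, 6, 7 (mod 8) divides no x² + 1 (Fermat descent).  If gcd(N, a, q) = 1, a
-- Bézout inverse y of q modulo N gives N ∣ (ya)² + 1; otherwise a common factor g of
-- N, a, q is prime to c by primitivity, so g² ∣ cN = q² - ab forces g² ∣ N, and the
-- data descends to N/g², which has the same residue mod 8 as N.  For the types (8, 7)
-- and (8, 11) the odd residues mod 24 are 3 or 7 mod 8, and two equal ones would give
-- a + b ≡ 6 (mod 8).

open import Defs

-- Divisors of x² + 1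

module _ where
  open import Data.Nat
  open import Data.Nat.Properties
  open import Data.Nat.DivMod
  open import Data.Nat.Divisibility
  open import Data.Nat.Induction using (<-rec)
  open import Data.Fin using (Fin; toℕ)
  open import Data.Fin.Properties using (all?; toℕ-fromℕ<)
  open import Data.List using (_∷_; [])
  open import Data.List.Membership.Propositional using (_∈_)
  open import Data.List.Membership.DecPropositional _≟_ using (_∈?_)
  open import Relation.Nullary using (Dec; contradiction)
  open import Relation.Nullary.Decidable using (toWitness; toWitnessFalse; _→-dec_)
  open import Relation.Binary.PropositionalEquality

  Residue367 : ℕ → Set
  Residue367 n = n % 8 ∈ 3 ∷ 6 ∷ 7 ∷ []

  residue367? : ∀ n → Dec (Residue367 n)
  residue367? n = n % 8 ∈? 3 ∷ 6 ∷ 7 ∷ []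

  residue367-cong : ∀ m n → m % 8 ≡ n % 8 → Residue367 m → Residue367 n
  residue367-cong m n = subst (_∈ 3 ∷ 6 ∷ 7 ∷ [])

  lift-mod8₂ : (P : ℕ → ℕ → Set) → (∀ (a b : Fin 8) → P (toℕ a) (toℕ b)) →
    ∀ a b → P (a % 8) (b % 8)
  lift-mod8₂ P h a b = subst₂ P (toℕ-fromℕ< (m%n<n a 8)) (toℕ-fromℕ< (m%n<n b 8)) (h (a mod 8) (b mod 8))

  lift-mod8₃ : (P : ℕ → ℕ → ℕ → Set) → (∀ (a b c : Fin 8) → P (toℕ a) (toℕ b) (toℕ c)) →
    ∀ a b c → P (a % 8) (b % 8) (c % 8)
  lift-mod8₃ P h a b c = lift-mod8₂ (P (a % 8))
    (λ b′ c′ → subst (λ a′ → P a′ (toℕ b′) (toℕ c′)) (toℕ-fromℕ< (m%n<n a 8)) (h (a mod 8) b′ c′)) b c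

  Cofactor : ℕ → ℕ → ℕ → Set
  Cofactor x m n = Residue367 n → (x * x + 1) % 8 ≡ (m * n) % 8 → Residue367 m

  SquareCofactor : ℕ → ℕ → Set
  SquareCofactor m g = Residue367 (m * (g * g)) → Residue367 m

  cofactor-residues : ∀ (x m n : Fin 8) → Cofactor (toℕ x) (toℕ m) (toℕ n)
  cofactor-residues = toWitness {a? = all? λ x → all? λ m → all? λ n →
    residue367? (toℕ n) →-dec ((toℕ x * toℕ x + 1) % 8 ≟ (toℕ m * toℕ n) % 8) →-dec residue367? (toℕ m)} _

  squareCofactor-residues : ∀ (m g : Fin 8) → SquareCofactor (toℕ m) (toℕ g)
  squareCofactor-residues = toWitness {a? = all? λ m → all? λ g →
    residue367? (toℕ m * (toℕ g * toℕ g)) →-dec residue367? (toℕ m)} _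

  [m*[n%d]]%d≡[m*n]%d : ∀ m n d .{{_ : NonZero d}} → (m * (n % d)) % d ≡ (m * n) % d
  [m*[n%d]]%d≡[m*n]%d m n d = begin
    (m * (n % d)) % d            ≡⟨ %-distribˡ-* m (n % d) d ⟩
    ((m % d) * (n % d % d)) % d  ≡⟨ cong (λ t → ((m % d) * t) % d) (m%n%n≡m%n n d) ⟩
    ((m % d) * (n % d)) % d      ≡⟨ %-distribˡ-* m n d ⟨
    (m * n) % d                  ∎
    where open ≡-Reasoning

  [x%d*x%d+1]%d≡[x*x+1]%d : ∀ x d .{{_ : NonZero d}} → ((x % d) * (x % d) + 1) % d ≡ (x * x + 1) % d
  [x%d*x%d+1]%d≡[x*x+1]%d x d = begin
    ((x % d) * (x % d) + 1) % d           ≡⟨ %-distribˡ-+ ((x % d) * (x % d)) 1 d ⟩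
    (((x % d) * (x % d)) % d + 1 % d) % d ≡⟨ cong (λ t → (t + 1 % d) % d) (%-distribˡ-* x x d) ⟨
    ((x * x) % d + 1 % d) % d             ≡⟨ %-distribˡ-+ (x * x) 1 d ⟨
    (x * x + 1) % d                       ∎
    where open ≡-Reasoning

  residue367-cofactor : ∀ x m n → Residue367 n → x * x + 1 ≡ m * n → Residue367 m
  residue367-cofactor x m n bad eq = residue367-cong (m % 8) m (m%n%n≡m%n m 8)
    (lift-mod8₃ Cofactor cofactor-residues x m n (residue367-cong n (n % 8) (sym (m%n%n≡m%n n 8)) bad) (begin
      ((x % 8) * (x % 8) + 1) % 8 ≡⟨ [x%d*x%d+1]%d≡[x*x+1]%d x 8 ⟩
      (x * x + 1) % 8             ≡⟨ cong (_% 8) eq ⟩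
      (m * n) % 8                 ≡⟨ %-distribˡ-* m n 8 ⟩
      ((m % 8) * (n % 8)) % 8     ∎))
    where open ≡-Reasoning

  residue367-÷square : ∀ m g → Residue367 (m * (g * g)) → Residue367 m
  residue367-÷square m g bad = residue367-cong (m % 8) m (m%n%n≡m%n m 8)
    (lift-mod8₂ SquareCofactor squareCofactor-residues m g
      (residue367-cong (m * (g * g)) ((m % 8) * ((g % 8) * (g % 8))) (begin
        (m * (g * g)) % 8                         ≡⟨ %-distribˡ-* m (g * g) 8 ⟩
        ((m % 8) * ((g * g) % 8)) % 8             ≡⟨ cong (λ t → ((m % 8) * t) % 8) (%-distribˡ-* g g 8) ⟩
        ((m % 8) * (((g % 8) * (g % 8)) % 8)) % 8 ≡⟨ [m*[n%d]]%d≡[m*n]%d (m % 8) ((g % 8) * (g % 8)) 8 ⟩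
        ((m % 8) * ((g % 8) * (g % 8))) % 8       ∎) bad))
    where open ≡-Reasoning

  residue367⇒1<n : ∀ n → Residue367 n → 1 < n
  residue367⇒1<n 0             bad = contradiction bad (toWitnessFalse {a? = residue367? 0} _)
  residue367⇒1<n 1             bad = contradiction bad (toWitnessFalse {a? = residue367? 1} _)
  residue367⇒1<n (suc (suc n)) _   = s≤s (s≤s z≤n)

  ∣x*x+1⇒∣r*r+1 : ∀ {n} x .{{_ : NonZero n}} → n ∣ x * x + 1 → n ∣ (x % n) * (x % n) + 1
  ∣x*x+1⇒∣r*r+1 {n} x n∣ = m%n≡0⇒n∣m _ n (trans ([x%d*x%d+1]%d≡[x*x+1]%d x n) (n∣m⇒m%n≡0 _ n n∣))

  r*r+1<n*n : ∀ {r n} → r < n → 1 < n → r * r + 1 < n * n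
  r*r+1<n*n {r} {n} r<n 1<n = begin-strict
    r * r + 1  ≤⟨ +-monoˡ-≤ 1 (*-monoʳ-≤ r (<⇒≤ r<n)) ⟩
    r * n + 1  <⟨ +-monoʳ-< (r * n) 1<n ⟩
    r * n + n  ≡⟨ +-comm (r * n) n ⟩
    suc r * n  ≤⟨ *-monoˡ-≤ n r<n ⟩
    n * n      ∎
    where open ≤-Reasoning

  -- With r = x mod n, r² + 1 = m n has a cofactor m < n, again with residue 3, 6 or 7.
  residue367∤x*x+1 : ∀ n → Residue367 n → ∀ x → n ∤ x * x + 1
  residue367∤x*x+1 = <-rec _ descent
    where
    descent : ∀ n → (∀ {m} → m < n → Residue367 m → ∀ x → m ∤ x * x + 1) →
      Residue367 n → ∀ x → n ∤ x * x + 1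
    descent n rec bad x n∣x*x+1 with residue367⇒1<n n bad
    ... | 1<n@(s≤s (s≤s _)) = rec m<n (residue367-cofactor r m n bad r*r+1≡mn) r (divides n (trans r*r+1≡mn (*-comm m n)))
      where
      r = x % n
      open _∣_ (∣x*x+1⇒∣r*r+1 x n∣x*x+1) renaming (quotient to m; equality to r*r+1≡mn)
      m<n : m < n
      m<n = *-cancelʳ-< n m n (subst (_< n * n) r*r+1≡mn (r*r+1<n*n (m%n<n x n) 1<n))

open import Data.Nat as ℕ using (ℕ; zero; suc; s≤s; z≤n)
import Data.Nat.Properties as ℕ
import Data.Nat.Divisibility as ℕ
import Data.Nat.DivMod as ℕ
open import Data.Nat.Induction using (<-rec)
open import Data.Nat.Coprimality using (Coprime; coprime-Bézout; coprime-divisor)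
open import Data.Nat.GCD using (module Bézout; gcd; gcd[m,n]∣m; gcd[m,n]∣n; gcd-greatest)
open import Data.Nat.Primality using (euclidsLemma; prime[2])
open import Data.Fin using (Fin; suc; _≟_; punchIn; punchOut)
open import Data.Fin.Properties using (punchInᵢ≢i; punchIn-punchOut)
open import Data.Fin.Patterns using (0F; 1F; 2F; 3F)
open import Data.Vec.Functional using (Vector; removeAt; _∷_; []; tail)
open import Data.Integer using (ℤ; +_; -[1+_]; +[1+_]; _+_; _-_; _*_; ∣_∣; _<_; +<+; _%ℕ_; _/ℕ_; nonNegative)
open import Data.Integer.Properties
  using ( pos-+; pos-*; abs-*; +-comm; *-comm; *-assoc; *-distribʳ-+; +-identityʳ; *-zeroʳ
        ; +-injective; i≡j⇒i-j≡0; i-j≡0⇒i≡j; ∣i∣≡0⇒i≡0; [+m]-[+n]≡m⊖n; ∣m⊝n∣≤m⊔n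
        ; *-cancelˡ-≡; *-cancelʳ-≡; *-cancelˡ-<-nonNeg; <⇒≤; +-0-commutativeMonoid )
open import Data.Integer.DivMod using (a≡a%ℕn+[a/ℕn]*n; n%ℕd<d)
open import Data.Integer.Divisibility.Signed
open import Data.Integer.Tactic.RingSolver using (solve-∀)
open import Algebra.Properties.CommutativeMonoid.Sum +-0-commutativeMonoid using (sum; sum-remove; sum-cong-≗)
open import Data.List.Relation.Unary.Any using (here; there)
open import Data.List.Membership.Propositional using (_∈_)
import Data.List.Relation.Unary.All as All
open import Data.Product using (∃; _×_; _,_; proj₁; proj₂)
open import Data.Sum using (_⊎_; inj₁; inj₂; [_,_]′)
open import Data.Empty using (⊥)
open import Function.Base using (id; _∘_)
open import Function.Bundles using (Equivalence)
open import Relation.Nullary using (¬_; Dec; yes; no; contradiction)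
open import Relation.Nullary.Decidable using (toWitness; _→-dec_; _⊎-dec_)
open import Relation.Binary.PropositionalEquality

-- Divisors of sums of two squares

square≡∣∣² : ∀ x → x * x ≡ + (∣ x ∣ ℕ.* ∣ x ∣)
square≡∣∣² (+ n)    = sym (pos-* n n)
square≡∣∣² -[1+ n ] = refl

residue367∤X*X+1 : ∀ {n} → Residue367 n → ∀ X → ¬ (+ n ∣ X * X + + 1)
residue367∤X*X+1 {n} bad X n∣ = residue367∤x*x+1 n bad ∣ X ∣ (subst (n ℕ.∣_) ∣X*X+1∣ (∣⇒∣ᵤ n∣))
  where
  ∣X*X+1∣ : ∣ X * X + + 1 ∣ ≡ ∣ X ∣ ℕ.* ∣ X ∣ ℕ.+ 1
  ∣X*X+1∣ = cong ∣_∣ (trans (cong (_+ + 1) (square≡∣∣² X)) (sym (pos-+ (∣ X ∣ ℕ.* ∣ X ∣) 1)))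

+n∣+[x*n] : ∀ x n → + n ∣ + (x ℕ.* n)
+n∣+[x*n] x n = divides (+ x) (pos-* x n)

bézout-±1 : ∀ {n q} → Coprime n q → ∃ λ y → (+ n ∣ + y * + q + + 1) ⊎ (+ n ∣ + y * + q - + 1)
bézout-±1 {n} {q} cop with coprime-Bézout cop
... | Bézout.+- x y eq = y , inj₁ (subst (+ n ∣_) (begin
  + (x ℕ.* n)         ≡⟨ cong +_ eq ⟨
  + (1 ℕ.+ y ℕ.* q)   ≡⟨ pos-+ 1 (y ℕ.* q) ⟩
  + 1 + + (y ℕ.* q)   ≡⟨ +-comm (+ 1) (+ (y ℕ.* q)) ⟩
  + (y ℕ.* q) + + 1   ≡⟨ cong (_+ + 1) (pos-* y q) ⟩
  + y * + q + + 1     ∎) (+n∣+[x*n] x n))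
  where open ≡-Reasoning
... | Bézout.-+ x y eq = y , inj₂ (subst (+ n ∣_) (begin
  + (x ℕ.* n)               ≡⟨ cancel (+ (x ℕ.* n)) ⟨
  + 1 + + (x ℕ.* n) - + 1   ≡⟨ cong (_- + 1) (pos-+ 1 (x ℕ.* n)) ⟨
  + (1 ℕ.+ x ℕ.* n) - + 1   ≡⟨ cong (λ t → + t - + 1) eq ⟩
  + (y ℕ.* q) - + 1         ≡⟨ cong (_- + 1) (pos-* y q) ⟩
  + y * + q - + 1           ∎) (+n∣+[x*n] x n))
  where
  open ≡-Reasoning
  cancel : ∀ z → + 1 + z - + 1 ≡ z
  cancel = solve-∀

coprime-sumSq⇒∣X*X+1 : ∀ {n q} A → + n ∣ A * A + + q * + q → Coprime n q → ∃ λ X → + n ∣ X * X + + 1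
coprime-sumSq⇒∣X*X+1 {n} {q} A n∣ n⊥q with bézout-±1 n⊥q
... | y , n∣w±1 = + y * A , subst (+ n ∣_) (identity (+ y) A (+ q))
                             (∣m∣n⇒∣m-n (∣n⇒∣m*n (+ y * + y) n∣) (n∣w*w-1 n∣w±1))
  where
  w = + y * + q
  identity : ∀ y A q → (y * y) * (A * A + q * q) - ((y * q) * (y * q) - + 1) ≡ (y * A) * (y * A) + + 1
  identity = solve-∀
  difference-of-squares : ∀ w → (w + + 1) * (w - + 1) ≡ w * w - + 1
  difference-of-squares = solve-∀
  n∣w*w-1 : (+ n ∣ w + + 1) ⊎ (+ n ∣ w - + 1) → + n ∣ w * w - + 1
  n∣w*w-1 (inj₁ n∣w+1) = subst (+ n ∣_) (difference-of-squares w) (∣m⇒∣m*n (w - + 1) n∣w+1)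
  n∣w*w-1 (inj₂ n∣w-1) = subst (+ n ∣_) (difference-of-squares w) (∣n⇒∣m*n (w + + 1) n∣w-1)

sumSq⇒coprime : ∀ {n} A Q → + n ∣ A * A + Q * Q →
  (∀ {d} → d ℕ.∣ n → d ℕ.∣ ∣ A ∣ → d ℕ.∣ ∣ Q ∣ → d ≡ 1) → Coprime n ∣ Q ∣
sumSq⇒coprime {n} A Q n∣ noCommon {d} (d∣n , d∣Q) = noCommon d∣n d∣A d∣Q
  where
  d∣A*A : d ℕ.∣ ∣ A ∣ ℕ.* ∣ A ∣
  d∣A*A = subst (d ℕ.∣_) (abs-* A A) (∣⇒∣ᵤ {+ d} {A * A}
    (∣m+n∣n⇒∣m (∣-trans (∣ᵤ⇒∣ {+ d} {+ n} d∣n) n∣) (∣n⇒∣m*n Q (∣ᵤ⇒∣ {+ d} {Q} d∣Q))))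
  d∣A : d ℕ.∣ ∣ A ∣
  d∣A = coprime-divisor (λ (e∣d , e∣A) → noCommon (ℕ.∣-trans e∣d d∣n) e∣A (ℕ.∣-trans e∣d d∣Q)) d∣A*A

residue367∣sumSq⇒common-factor : ∀ {n} → Residue367 n → ∀ A Q → + n ∣ A * A + Q * Q →
  ¬ (∀ {d} → d ℕ.∣ n → d ℕ.∣ ∣ A ∣ → d ℕ.∣ ∣ Q ∣ → d ≡ 1)
residue367∣sumSq⇒common-factor {n} bad A Q n∣ noCommon =
  let X , n∣X*X+1 = coprime-sumSq⇒∣X*X+1 A n∣′ (sumSq⇒coprime A Q n∣ noCommon)
  in residue367∤X*X+1 bad X n∣X*X+1
  where
  n∣′ : + n ∣ A * A + + ∣ Q ∣ * + ∣ Q ∣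
  n∣′ = subst (λ t → + n ∣ A * A + t) (trans (square≡∣∣² Q) (pos-* ∣ Q ∣ ∣ Q ∣)) n∣

-- Descent

coprime-square-divisor : ∀ {g c m} .{{_ : ℕ.NonZero g}} → Coprime g c →
  g ℕ.* g ℕ.∣ c ℕ.* m → g ℕ.* g ℕ.∣ m
coprime-square-divisor {g} {c} cop gg∣cm with coprime-divisor cop (ℕ.m*n∣⇒m∣ g g gg∣cm)
... | ℕ.divides m₁ refl with coprime-divisor cop (ℕ.*-cancelʳ-∣ g (subst (g ℕ.* g ℕ.∣_) (sym (ℕ.*-assoc c m₁ g)) gg∣cm))
... | ℕ.divides m₂ refl = ℕ.divides m₂ (ℕ.*-assoc m₂ g g)

-- For tangent a, b in a Descartes quadruple (a, b, c, d), take N = a + b and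
-- q = (a + b + c - d)/2.  Dividing out common factors only preserves N ∣ a + b.
record DescentData (N : ℕ) : Set where
  constructor descentData
  field
    a b c q   : ℤ
    N∣a+b     : + N ∣ a + b
    q*q≡ab+cN : q * q ≡ a * b + c * + N
    common∣1  : ∀ h → h ∣ a → h ∣ b → h ∣ c → h ∣ q → h ∣ + 1

module _ {N} (D : DescentData N) where
  open DescentData D

  N∣a*a+q*q : + N ∣ a * a + q * q
  N∣a*a+q*q = subst (+ N ∣_) (begin
    a * (a + b) + c * + N       ≡⟨ expand a b (c * + N) ⟩
    a * a + (a * b + c * + N)   ≡⟨ cong (λ t → a * a + t) q*q≡ab+cN ⟨
    a * a + q * q               ∎)
    (∣m∣n⇒∣m+n (∣n⇒∣m*n a N∣a+b) (∣n⇒∣m*n c ∣-refl))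
    where
    open ≡-Reasoning
    expand : ∀ a b x → a * (a + b) + x ≡ a * a + (a * b + x)
    expand = solve-∀

  ∣N∣a⇒∣b : ∀ {g} → g ∣ + N → g ∣ a → g ∣ b
  ∣N∣a⇒∣b g∣N g∣a = ∣m+n∣m⇒∣n (∣-trans g∣N N∣a+b) g∣a

  -- g is prime to c by primitivity, so g² ∣ c N = q² - a b forces g² ∣ N.
  square-factor : ∀ g .{{_ : ℕ.NonZero g}} → g ℕ.∣ N → + g ∣ a → + g ∣ q → g ℕ.* g ℕ.∣ N
  square-factor g g∣N g∣a g∣q =
    coprime-square-divisor g⊥c (subst (g ℕ.* g ℕ.∣_) (abs-* c (+ N)) (∣⇒∣ᵤ gg∣cN))
    where
    g∣b : + g ∣ b
    g∣b = ∣N∣a⇒∣b (∣ᵤ⇒∣ g∣N) g∣a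
    g⊥c : Coprime g ∣ c ∣
    g⊥c {d} (d∣g , d∣c) = ℕ.∣1⇒≡1 (∣⇒∣ᵤ (common∣1 (+ d)
      (∣-trans (∣ᵤ⇒∣ d∣g) g∣a) (∣-trans (∣ᵤ⇒∣ d∣g) g∣b) (∣ᵤ⇒∣ d∣c) (∣-trans (∣ᵤ⇒∣ d∣g) g∣q)))
    gg∣cN : + (g ℕ.* g) ∣ c * + N
    gg∣cN = subst₂ _∣_ (sym (pos-* g g)) (y+x-y≡x (a * b) (c * + N))
      (subst (λ t → + g * + g ∣ t - a * b) q*q≡ab+cN
        (∣m∣n⇒∣m-n (∣-trans (*-monoʳ-∣ (+ g) g∣q) (*-monoˡ-∣ q g∣q))
                   (∣-trans (*-monoʳ-∣ (+ g) g∣b) (*-monoˡ-∣ b g∣a))))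
      where
      y+x-y≡x : ∀ y x → y + x - y ≡ x
      y+x-y≡x = solve-∀

divide : ∀ {N N′} g .{{_ : ℕ.NonZero g}} (D : DescentData N) → N ≡ N′ ℕ.* (g ℕ.* g) →
  let open DescentData D in + g ∣ a → + g ∣ b → + g ∣ q → DescentData N′
divide {N′ = N′} g (descentData _ _ c _ N∣a+b eq common∣1) refl (divides a′ refl) (divides b′ refl) (divides q′ refl) =
  descentData a′ b′ c q′ N′∣a′+b′ eq′ common∣1′
  where
  open ≡-Reasoning
  G = + g
  N≡N′GG : + (N′ ℕ.* (g ℕ.* g)) ≡ + N′ * G * G
  N≡N′GG = trans (pos-* N′ (g ℕ.* g)) (trans (cong (+ N′ *_) (pos-* g g)) (sym (*-assoc (+ N′) G G)))
  N′∣a′+b′ : + N′ ∣ a′ + b′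
  N′∣a′+b′ = ∣-trans (∣m⇒∣m*n G ∣-refl) (*-cancelʳ-∣ G (subst₂ _∣_ N≡N′GG (sym (*-distribʳ-+ G a′ b′)) N∣a+b))
  eq′ : q′ * q′ ≡ a′ * b′ + c * + N′
  eq′ = *-cancelʳ-≡ (q′ * q′) (a′ * b′ + c * + N′) (+ (g ℕ.* g)) {{ℕ.m*n≢0 g g}} (begin
    q′ * q′ * + (g ℕ.* g)                         ≡⟨ cong (q′ * q′ *_) (pos-* g g) ⟩
    q′ * q′ * (G * G)                             ≡⟨ regroupˡ q′ G ⟩
    q′ * G * (q′ * G)                             ≡⟨ eq ⟩
    a′ * G * (b′ * G) + c * + (N′ ℕ.* (g ℕ.* g))  ≡⟨ cong (λ t → a′ * G * (b′ * G) + c * t) N≡N′GG ⟩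
    a′ * G * (b′ * G) + c * (+ N′ * G * G)        ≡⟨ regroupʳ a′ b′ c (+ N′) G ⟩
    (a′ * b′ + c * + N′) * (G * G)                ≡⟨ cong ((a′ * b′ + c * + N′) *_) (pos-* g g) ⟨
    (a′ * b′ + c * + N′) * + (g ℕ.* g)            ∎)
    where
    regroupˡ : ∀ q G → q * q * (G * G) ≡ q * G * (q * G)
    regroupˡ = solve-∀
    regroupʳ : ∀ a b c n G → a * G * (b * G) + c * (n * G * G) ≡ (a * b + c * n) * (G * G)
    regroupʳ = solve-∀
  common∣1′ : ∀ h → h ∣ a′ → h ∣ b′ → h ∣ c → h ∣ q′ → h ∣ + 1
  common∣1′ h h∣a′ h∣b′ h∣c h∣q′ = common∣1 h (∣m⇒∣m*n G h∣a′) (∣m⇒∣m*n G h∣b′) h∣c (∣m⇒∣m*n G h∣q′)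

no-descentData : ∀ N → Residue367 N → ¬ DescentData N
no-descentData = <-rec _ descend
  where
  descend : ∀ N → (∀ {N′} → N′ ℕ.< N → Residue367 N′ → ¬ DescentData N′) → Residue367 N → ¬ DescentData N
  descend N rec bad D = by-common-factor (gcd N (gcd ∣ a ∣ ∣ q ∣))
    (gcd[m,n]∣m N (gcd ∣ a ∣ ∣ q ∣))
    (ℕ.∣-trans (gcd[m,n]∣n N (gcd ∣ a ∣ ∣ q ∣)) (gcd[m,n]∣m ∣ a ∣ ∣ q ∣))
    (ℕ.∣-trans (gcd[m,n]∣n N (gcd ∣ a ∣ ∣ q ∣)) (gcd[m,n]∣n ∣ a ∣ ∣ q ∣))
    (λ d∣N d∣a d∣q → gcd-greatest d∣N (gcd-greatest d∣a d∣q))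
    where
    open DescentData D
    N≢0 : N ≢ 0
    N≢0 refl = contradiction (residue367⇒1<n 0 bad) λ ()
    shrink : ∀ g .{{_ : ℕ.NonZero g}} → 1 ℕ.< g → g ℕ.∣ N → g ℕ.∣ ∣ a ∣ → g ℕ.∣ ∣ q ∣ → ⊥
    shrink g 1<g g∣N g∣a g∣q =
      rec N′<N (residue367-÷square N′ g (subst Residue367 N≡N′gg bad))
        (divide g D N≡N′gg (∣ᵤ⇒∣ g∣a) (∣N∣a⇒∣b D (∣ᵤ⇒∣ g∣N) (∣ᵤ⇒∣ g∣a)) (∣ᵤ⇒∣ g∣q))
      where
      open ℕ._∣_ (square-factor D g g∣N (∣ᵤ⇒∣ g∣a) (∣ᵤ⇒∣ g∣q)) renaming (quotient to N′; equality to N≡N′gg)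
      N′<N : N′ ℕ.< N
      N′<N = subst (N′ ℕ.<_) (sym N≡N′gg)
        (ℕ.m<m*n N′ (g ℕ.* g) {{ℕ.≢-nonZero λ N′≡0 → N≢0 (trans N≡N′gg (cong (ℕ._* (g ℕ.* g)) N′≡0))}}
          (ℕ.*-mono-< 1<g 1<g))
    by-common-factor : ∀ g → g ℕ.∣ N → g ℕ.∣ ∣ a ∣ → g ℕ.∣ ∣ q ∣ →
      (∀ {d} → d ℕ.∣ N → d ℕ.∣ ∣ a ∣ → d ℕ.∣ ∣ q ∣ → d ℕ.∣ g) → ⊥
    by-common-factor 0 g∣N _ _ _ = N≢0 (ℕ.0∣⇒≡0 g∣N)
    by-common-factor 1 _ _ _ greatest =
      residue367∣sumSq⇒common-factor bad a q (N∣a*a+q*q D) (λ d∣N d∣a d∣q → ℕ.∣1⇒≡1 (greatest d∣N d∣a d∣q))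
    by-common-factor g@(suc (suc _)) g∣N g∣a g∣q _ = shrink g (s≤s (s≤s z≤n)) g∣N g∣a g∣q

-- Descartes quadruples

CommonDivisor : ℤ → Quad → Set
CommonDivisor h q = ∀ k → h ∣ q k

PrimitiveQuad : Quad → Set
PrimitiveQuad q = ∀ h → CommonDivisor h q → h ∣ + 1

sum-squares-ℕ : ∀ {n} (t : Vector ℤ n) → ∃ λ m → sum (λ k → t k * t k) ≡ + m
sum-squares-ℕ {zero}  t = 0 , refl
sum-squares-ℕ {suc n} t =
  let m , eq = sum-squares-ℕ (tail t) in
  ∣ t 0F ∣ ℕ.* ∣ t 0F ∣ ℕ.+ m , trans (cong₂ _+_ (square≡∣∣² (t 0F)) eq) (sym (pos-+ _ m))

nonneg-of-positive-sum : ∀ s t {n} → + 0 < s + t → + 2 * (s * t) ≡ + n → ∃ λ m → s ≡ + m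
nonneg-of-positive-sum (+ m)    _        _  _  = m , refl
nonneg-of-positive-sum -[1+ _ ] (+ 0)    () _
nonneg-of-positive-sum -[1+ _ ] +[1+ _ ] _  ()
nonneg-of-positive-sum -[1+ _ ] -[1+ _ ] () _

module _ (p : Quad) (descartes : Descartes p) where
  private
    a = p 0F
    b = p 1F
    c = p 2F
    d = p 3F

  -- 2 (a + b)(c + d) = (a - b)² + (c - d)² on Descartes quadruples.
  pair-sum-nonneg : + 0 < total p → ∃ λ n → a + b ≡ + n
  pair-sum-nonneg 0<T =
    let n , squares≡n = sum-squares-ℕ ((a - b) ∷ (c - d) ∷ []) in
    nonneg-of-positive-sum (a + b) (c + d) (subst (+ 0 <_) (regroup a b c d) 0<T) (begin
      + 2 * ((a + b) * (c + d))
        ≡⟨ identity a b c d ⟩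
      (a - b) * (a - b) + ((c - d) * (c - d) + + 0) + (total p * total p - + 2 * sumSq p)
        ≡⟨ cong (λ t → (a - b) * (a - b) + ((c - d) * (c - d) + + 0) + t) (i≡j⇒i-j≡0 descartes) ⟩
      (a - b) * (a - b) + ((c - d) * (c - d) + + 0) + + 0
        ≡⟨ +-identityʳ _ ⟩
      (a - b) * (a - b) + ((c - d) * (c - d) + + 0)
        ≡⟨ squares≡n ⟩
      + n ∎)
    where
    open ≡-Reasoning
    regroup : ∀ a b c d → a + b + c + d ≡ (a + b) + (c + d)
    regroup = solve-∀
    identity : ∀ a b c d → + 2 * ((a + b) * (c + d)) ≡ (a - b) * (a - b) + ((c - d) * (c - d) + + 0)
      + ((a + b + c + d) * (a + b + c + d) - + 2 * (a * a + b * b + c * c + d * d))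
    identity = solve-∀

  total-even : ∃ λ w → total p ≡ w * + 2
  total-even =
    let divides w T≡2w = ∣ᵤ⇒∣ {+ 2} {total p} ([ id , id ]′ (euclidsLemma ∣ total p ∣ ∣ total p ∣ prime[2] 2∣T*T))
    in w , T≡2w
    where
    2∣T*T : 2 ℕ.∣ ∣ total p ∣ ℕ.* ∣ total p ∣
    2∣T*T = subst (2 ℕ.∣_) (abs-* (total p) (total p))
      (∣⇒∣ᵤ {+ 2} (divides (sumSq p) (trans descartes (*-comm (+ 2) (sumSq p)))))

  -- q = w - d = (a + b + c - d)/2, as in Descartes' d = a + b + c ∓ 2√(ab + bc + ca).
  q*q≡ab+c[a+b] : ∀ w → total p ≡ w * + 2 → (w - d) * (w - d) ≡ a * b + c * (a + b)
  q*q≡ab+c[a+b] w T≡2w = *-cancelˡ-≡ (+ 4) _ _ (begin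
    + 4 * ((w - d) * (w - d))                       ≡⟨ double w d ⟩
    (w * + 2 - + 2 * d) * (w * + 2 - + 2 * d)       ≡⟨ cong (λ t → (t - + 2 * d) * (t - + 2 * d)) T≡2w ⟨
    (total p - + 2 * d) * (total p - + 2 * d)       ≡⟨ identity a b c d ⟩
    + 4 * (a * b + c * (a + b)) + (+ 2 * sumSq p - total p * total p)
      ≡⟨ cong (λ t → + 4 * (a * b + c * (a + b)) + t) (i≡j⇒i-j≡0 (sym descartes)) ⟩
    + 4 * (a * b + c * (a + b)) + + 0               ≡⟨ +-identityʳ _ ⟩
    + 4 * (a * b + c * (a + b))                     ∎)
    where
    open ≡-Reasoning
    double : ∀ w d → + 4 * ((w - d) * (w - d)) ≡ (w * + 2 - + 2 * d) * (w * + 2 - + 2 * d)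
    double = solve-∀
    identity : ∀ a b c d → (a + b + c + d - + 2 * d) * (a + b + c + d - + 2 * d) ≡
      + 4 * (a * b + c * (a + b)) + (+ 2 * (a * a + b * b + c * c + d * d) - (a + b + c + d) * (a + b + c + d))
    identity = solve-∀

  common∣1-of-primitive : PrimitiveQuad p → ∀ w → total p ≡ w * + 2 →
    ∀ h → h ∣ a → h ∣ b → h ∣ c → h ∣ w - d → h ∣ + 1
  common∣1-of-primitive prim w T≡2w h h∣a h∣b h∣c h∣q = prim h λ { 0F → h∣a ; 1F → h∣b ; 2F → h∣c ; 3F → h∣d }
    where
    d≡ : a + b + c - + 2 * (w - d) ≡ d
    d≡ = trans (identity a b c d w) (trans (cong (λ t → d + t) (i≡j⇒i-j≡0 T≡2w)) (+-identityʳ d))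
      where
      identity : ∀ a b c d w → a + b + c - + 2 * (w - d) ≡ d + (a + b + c + d - w * + 2)
      identity = solve-∀
    h∣d : h ∣ d
    h∣d = subst (h ∣_) d≡ (∣m∣n⇒∣m-n (∣m∣n⇒∣m+n (∣m∣n⇒∣m+n h∣a h∣b) h∣c) (∣n⇒∣m*n (+ 2) h∣q))

  descartes-pair : + 0 < total p → PrimitiveQuad p →
    ∃ λ n → a + b ≡ + n × ¬ Residue367 n
  descartes-pair 0<T prim =
    let n , a+b≡n = pair-sum-nonneg 0<T
        w , T≡2w = total-even
    in n , a+b≡n , λ bad → no-descentData n bad (descentData a b c (w - d)
         (∣-reflexive (sym a+b≡n))
         (trans (q*q≡ab+c[a+b] w T≡2w) (cong (λ t → a * b + c * t) a+b≡n))
         (common∣1-of-primitive prim w T≡2w))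

-- The orbit under the Apollonian group

all-removeAt : ∀ {a} {A : Set a} {n} {P : A → Set} (t : Vector A (suc n)) i →
  P (t i) → (∀ k → P (removeAt t i k)) → ∀ m → P (t m)
all-removeAt {P = P} t i Pti Prest m with m ≟ i
... | yes refl = Pti
... | no m≢i = subst (P ∘ t) (punchIn-punchOut (m≢i ∘ sym)) (Prest (punchOut (m≢i ∘ sym)))

total≡sum : ∀ q → total q ≡ sum q
total≡sum q = regroup (q 0F) (q 1F) (q 2F) (q 3F)
  where
  regroup : ∀ a b c d → a + b + c + d ≡ a + (b + (c + (d + + 0)))
  regroup = solve-∀

sum-removeAt≡total-at : ∀ q i → sum (removeAt q i) ≡ total q - q i
sum-removeAt≡total-at q i = trans (sym (x+s-x≡s (q i) _)) (cong (_- q i) (sym (trans (total≡sum q) (sum-remove q))))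
  where
  x+s-x≡s : ∀ x s → x + s - x ≡ s
  x+s-x≡s = solve-∀

total-update : ∀ i (q r : Quad) → (∀ j → j ≢ i → r j ≡ q j) → total r ≡ r i + (total q - q i)
total-update i q r same = begin
  total r                   ≡⟨ total≡sum r ⟩
  sum r                     ≡⟨ sum-remove r ⟩
  r i + sum (removeAt r i)  ≡⟨ cong (_+_ (r i)) (sum-cong-≗ λ k → same (punchIn i k) (punchInᵢ≢i i k)) ⟩
  r i + sum (removeAt q i)  ≡⟨ cong (_+_ (r i)) (sum-removeAt≡total-at q i) ⟩
  r i + (total q - q i)     ∎
  where open ≡-Reasoning

square : Quad → Quad
square q k = q k * q k

move-self : ∀ i q → move i q i ≡ + 2 * (total q - q i) - q i
move-self i q with i ≟ i
... | yes _  = refl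
... | no i≢i = contradiction refl i≢i

move-other : ∀ {i j} q → j ≢ i → move i q j ≡ q j
move-other {i} {j} q j≢i with j ≟ i
... | yes j≡i = contradiction j≡i j≢i
... | no _    = refl

total-move : ∀ i q → total (move i q) ≡ move i q i + (total q - q i)
total-move i q = total-update i q (move i q) (λ _ → move-other q)

sumSq-move : ∀ i q → sumSq (move i q) ≡ move i q i * move i q i + (sumSq q - q i * q i)
sumSq-move i q = total-update i (square q) (square (move i q)) (λ _ j≢i → cong₂ _*_ (move-other q j≢i) (move-other q j≢i))

move-descartes : ∀ i q → Descartes q → Descartes (move i q)
move-descartes i q descartes = i-j≡0⇒i≡j _ _ (begin
  total q′ * total q′ - + 2 * sumSq q′
    ≡⟨ cong₂ (λ t s → t * t - + 2 * s) (total-move i q) (sumSq-move i q) ⟩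
  (q′ i + (T - x)) * (q′ i + (T - x)) - + 2 * (q′ i * q′ i + (S - x * x))
    ≡⟨ cong (λ y → (y + (T - x)) * (y + (T - x)) - + 2 * (y * y + (S - x * x))) (move-self i q) ⟩
  (x′ + (T - x)) * (x′ + (T - x)) - + 2 * (x′ * x′ + (S - x * x))
    ≡⟨ invariant T x S ⟩
  T * T - + 2 * S
    ≡⟨ i≡j⇒i-j≡0 descartes ⟩
  + 0 ∎)
  where
  open ≡-Reasoning
  q′ = move i q
  T = total q
  S = sumSq q
  x = q i
  x′ = + 2 * (T - x) - x
  invariant : ∀ T x S → let x′ = + 2 * (T - x) - x in
    (x′ + (T - x)) * (x′ + (T - x)) - + 2 * (x′ * x′ + (S - x * x)) ≡ T * T - + 2 * S
  invariant = solve-∀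

sumSq-others-ℕ : ∀ q i → ∃ λ w → sumSq q - q i * q i ≡ + w
sumSq-others-ℕ q i =
  let w , others≡w = sum-squares-ℕ (removeAt q i) in w , trans (sym (sum-removeAt≡total-at (square q) i)) others≡w

0<x*x+n : ∀ {x} n → + 0 < x → + 0 < x * x + + n
0<x*x+n {+[1+ _ ]} _ _         = +<+ (s≤s z≤n)
0<x*x+n {+ 0}      _ (+<+ ())

-- 6 T T′ = T² + 2 (2T - 3x)² + 18 (S - x²) + 9 (T² - 2S), and S - x² is a sum of three squares.
move-positive : ∀ i q → Descartes q → + 0 < total q → + 0 < total (move i q)
move-positive i q descartes 0<T =
  *-cancelˡ-<-nonNeg T {{nonNegative (<⇒≤ 0<T)}} (subst (_< T * T′) (sym (*-zeroʳ T))
    (*-cancelˡ-<-nonNeg (+ 6) (subst (+ 0 <_) (sym 6TT′≡) (0<x*x+n M 0<T))))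
  where
  open ≡-Reasoning
  T = total q
  T′ = total (move i q)
  S = sumSq q
  x = q i
  y = + 2 * T - + 3 * x
  w = proj₁ (sumSq-others-ℕ q i)
  W≡w : S - x * x ≡ + w
  W≡w = proj₂ (sumSq-others-ℕ q i)
  M = 2 ℕ.* (∣ y ∣ ℕ.* ∣ y ∣) ℕ.+ 18 ℕ.* w
  rest = + 2 * (y * y) + + 18 * (S - x * x)
  rest≡M : rest ≡ + M
  rest≡M = begin
    + 2 * (y * y) + + 18 * (S - x * x)           ≡⟨ cong₂ (λ s t → + 2 * s + + 18 * t) (square≡∣∣² y) W≡w ⟩
    + 2 * + (∣ y ∣ ℕ.* ∣ y ∣) + + 18 * + w       ≡⟨ cong₂ _+_ (pos-* 2 (∣ y ∣ ℕ.* ∣ y ∣)) (pos-* 18 w) ⟨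
    + (2 ℕ.* (∣ y ∣ ℕ.* ∣ y ∣)) + + (18 ℕ.* w)   ≡⟨ pos-+ (2 ℕ.* (∣ y ∣ ℕ.* ∣ y ∣)) (18 ℕ.* w) ⟨
    + M                                          ∎
  6TT′≡ : + 6 * (T * T′) ≡ T * T + + M
  6TT′≡ = begin
    + 6 * (T * T′)                                          ≡⟨ cong (λ t → + 6 * (T * t)) (total-move i q) ⟩
    + 6 * (T * (move i q i + (T - x)))                      ≡⟨ cong (λ x′ → + 6 * (T * (x′ + (T - x)))) (move-self i q) ⟩
    + 6 * (T * (+ 2 * (T - x) - x + (T - x)))               ≡⟨ identity T x S ⟩
    T * T + rest + + 9 * (T * T - + 2 * S)                  ≡⟨ cong (λ t → T * T + rest + + 9 * t) (i≡j⇒i-j≡0 descartes) ⟩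
    T * T + rest + + 0                                      ≡⟨ +-identityʳ _ ⟩
    T * T + rest                                            ≡⟨ cong (λ t → T * T + t) rest≡M ⟩
    T * T + + M                                             ∎
    where
    identity : ∀ T x S → + 6 * (T * (+ 2 * (T - x) - x + (T - x))) ≡
      T * T + (+ 2 * ((+ 2 * T - + 3 * x) * (+ 2 * T - + 3 * x)) + + 18 * (S - x * x)) + + 9 * (T * T - + 2 * S)
    identity = solve-∀

∣total : ∀ {h} q → CommonDivisor h q → h ∣ total q
∣total q h∣q = ∣m∣n⇒∣m+n (∣m∣n⇒∣m+n (∣m∣n⇒∣m+n (h∣q 0F) (h∣q 1F)) (h∣q 2F)) (h∣q 3F)

move-common-divisor : ∀ {h} i q → CommonDivisor h q → CommonDivisor h (move i q)
move-common-divisor i q h∣q k with k ≟ i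
... | yes _ = ∣m∣n⇒∣m-n (∣n⇒∣m*n (+ 2) (∣m∣n⇒∣m-n (∣total q h∣q) (h∣q i))) (h∣q i)
... | no _  = h∣q k

move-involutive : ∀ i q k → move i (move i q) k ≡ q k
move-involutive i q k with k ≟ i
... | no k≢i    = move-other q k≢i
... | yes refl  = begin
  + 2 * (total (move k q) - x′) - x′  ≡⟨ cong (λ t → + 2 * (t - x′) - x′) (total-move k q) ⟩
  + 2 * (x′ + R - x′) - x′            ≡⟨ cong (λ y → + 2 * (y + R - y) - y) (move-self k q) ⟩
  + 2 * (+ 2 * R - q k + R - (+ 2 * R - q k)) - (+ 2 * R - q k) ≡⟨ reflect R (q k) ⟩
  q k                                 ∎
  where
  open ≡-Reasoning
  x′ = move k q k
  R = total q - q k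
  reflect : ∀ R x → + 2 * (+ 2 * R - x + R - (+ 2 * R - x)) - (+ 2 * R - x) ≡ x
  reflect = solve-∀

orbit-descartes-positive : ∀ {r q} → Descartes r → + 0 < total r → r ⇝ q → Descartes q × + 0 < total q
orbit-descartes-positive D P here = D , P
orbit-descartes-positive D P (step i r⇝q) =
  let D′ , P′ = orbit-descartes-positive D P r⇝q in move-descartes i _ D′ , move-positive i _ D′ P′

orbit-common-divisor : ∀ {h r q} → CommonDivisor h r → r ⇝ q → CommonDivisor h q
orbit-common-divisor h∣r here = h∣r
orbit-common-divisor h∣r (step i r⇝q) = move-common-divisor i _ (orbit-common-divisor h∣r r⇝q)

orbit-common-divisor⁻¹ : ∀ {h r q} → r ⇝ q → CommonDivisor h q → CommonDivisor h r
orbit-common-divisor⁻¹ here h∣q = h∣q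
orbit-common-divisor⁻¹ {h} (step {q} i r⇝q) h∣q′ =
  orbit-common-divisor⁻¹ r⇝q λ k → subst (h ∣_) (move-involutive i q k) (move-common-divisor i (move i q) h∣q′ k)

orbit-primitive : ∀ {r q} → Primitive r → r ⇝ q → PrimitiveQuad q
orbit-primitive {r} prim r⇝q h h∣q = ∣ᵤ⇒∣ (prim h λ { c (q′ , r⇝q′ , k , q′k≡c) →
  ∣⇒∣ᵤ (subst (h ∣_) q′k≡c (orbit-common-divisor (orbit-common-divisor⁻¹ r⇝q h∣q) r⇝q′ k)) })

frontPair : (q : Quad) (i j : Fin 4) → i ≢ j → Quad
frontPair q i j i≢j = q i ∷ removeAt q i (punchOut i≢j) ∷ removeAt (removeAt q i) (punchOut i≢j)

total-frontPair : ∀ q i j (i≢j : i ≢ j) → total (frontPair q i j i≢j) ≡ total q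
total-frontPair q i j i≢j = begin
  total (frontPair q i j i≢j)                    ≡⟨ total≡sum (frontPair q i j i≢j) ⟩
  q i + (rest j′ + sum (removeAt rest j′))       ≡⟨ cong (_+_ (q i)) (sum-remove rest) ⟨
  q i + sum rest                                 ≡⟨ sum-remove q ⟨
  sum q                                          ≡⟨ total≡sum q ⟨
  total q                                        ∎
  where
  open ≡-Reasoning
  rest = removeAt q i
  j′ = punchOut i≢j

pair-sum-not-residue367 : ∀ q → Descartes q → + 0 < total q → PrimitiveQuad q →
  ∀ i j → i ≢ j → ∃ λ n → q i + q j ≡ + n × ¬ Residue367 n
pair-sum-not-residue367 q descartes 0<T prim i j i≢j =
  let n , pair≡n , ¬bad = descartes-pair p descartes′ (subst (+ 0 <_) (sym (total-frontPair q i j i≢j)) 0<T) prim′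
  in n , trans (cong (λ k → q i + q k) (sym (punchIn-punchOut i≢j))) pair≡n , ¬bad
  where
  p = frontPair q i j i≢j
  descartes′ : Descartes p
  descartes′ = subst₂ (λ t s → t * t ≡ + 2 * s)
    (sym (total-frontPair q i j i≢j)) (sym (total-frontPair (square q) i j i≢j)) descartes
  prim′ : PrimitiveQuad p
  prim′ h h∣p = prim h (all-removeAt {P = h ∣_} q i (h∣p 0F)
    (all-removeAt {P = h ∣_} (removeAt q i) (punchOut i≢j) (h∣p 1F) (λ k → h∣p (suc (suc k)))))

tangent-sum-not-residue367 : ∀ r → PrimitiveIntegralPacking r → ∀ a b → TangentPair r a b →
  ∃ λ n → a + b ≡ + n × ¬ Residue367 n
tangent-sum-not-residue367 r (descartes , (_ , 0<T) , prim) a b (q , r⇝q , i , j , i≢j , qi≡a , qj≡b) =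
  let descartes′ , 0<T′ = orbit-descartes-positive descartes 0<T r⇝q
      n , sum≡n , ¬bad = pair-sum-not-residue367 q descartes′ 0<T′ (orbit-primitive prim r⇝q) i j i≢j
  in n , trans (cong₂ _+_ (sym qi≡a) (sym qj≡b)) sum≡n , ¬bad

-- Residues of integers

multiple<⇒≡0 : ∀ {d x} → d ℕ.∣ x → x ℕ.< d → x ≡ 0
multiple<⇒≡0 {x = zero}  _   _   = refl
multiple<⇒≡0 {x = suc _} d∣x x<d = contradiction d∣x (ℕ.>⇒∤ x<d)

remainder-unique : ∀ {d r s} k l → r ℕ.< d → s ℕ.< d → + r + k * + d ≡ + s + l * + d → r ≡ s
remainder-unique {d} {r} {s} k l r<d s<d eq = +-injective (i-j≡0⇒i≡j _ _ (∣i∣≡0⇒i≡0 (multiple<⇒≡0 (∣⇒∣ᵤ d∣r-s) ∣r-s∣<d)))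
  where
  open ≡-Reasoning
  d∣r-s : + d ∣ + r - + s
  d∣r-s = divides (l - k) (begin
    + r - + s                                  ≡⟨ shift (+ r) (+ s) k l (+ d) ⟩
    (+ r + k * + d) - (+ s + l * + d) + (l - k) * + d ≡⟨ cong (λ t → t - (+ s + l * + d) + (l - k) * + d) eq ⟩
    (+ s + l * + d) - (+ s + l * + d) + (l - k) * + d ≡⟨ cancel (+ s + l * + d) ((l - k) * + d) ⟩
    (l - k) * + d                              ∎)
    where
    shift : ∀ r s k l d → r - s ≡ (r + k * d) - (s + l * d) + (l - k) * d
    shift = solve-∀
    cancel : ∀ x y → x - x + y ≡ y
    cancel = solve-∀
  ∣r-s∣<d : ∣ + r - + s ∣ ℕ.< d
  ∣r-s∣<d = subst (ℕ._< d) (cong ∣_∣ (sym ([+m]-[+n]≡m⊖n r s))) (ℕ.≤-<-trans (∣m⊝n∣≤m⊔n r s) (ℕ.⊔-lub r<d s<d))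

%ℕ-unique : ∀ i d .{{_ : ℕ.NonZero d}} r k → i ≡ + r + k * + d → i %ℕ d ≡ r ℕ.% d
%ℕ-unique i d r k i≡ = remainder-unique (i /ℕ d) (k + + (r ℕ./ d)) (n%ℕd<d i d) (ℕ.m%n<n r d) (begin
  + (i %ℕ d) + (i /ℕ d) * + d                  ≡⟨ a≡a%ℕn+[a/ℕn]*n i d ⟨
  i                                            ≡⟨ i≡ ⟩
  + r + k * + d                                ≡⟨ cong (λ t → + t + k * + d) (ℕ.m≡m%n+[m/n]*n r d) ⟩
  + (r ℕ.% d ℕ.+ r ℕ./ d ℕ.* d) + k * + d      ≡⟨ cong (λ t → t + k * + d) (trans (pos-+ (r ℕ.% d) _) (cong (_+_ (+ (r ℕ.% d))) (pos-* (r ℕ./ d) d))) ⟩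
  + (r ℕ.% d) + + (r ℕ./ d) * + d + k * + d    ≡⟨ regroup (+ (r ℕ.% d)) (+ (r ℕ./ d)) k (+ d) ⟩
  + (r ℕ.% d) + (k + + (r ℕ./ d)) * + d        ∎)
  where
  open ≡-Reasoning
  regroup : ∀ x y k d → x + y * d + k * d ≡ x + (k + y) * d
  regroup = solve-∀

%ℕ-%-divisor : ∀ i m n .{{_ : ℕ.NonZero n}} .{{_ : ℕ.NonZero (m ℕ.* n)}} → i %ℕ n ≡ (i %ℕ (m ℕ.* n)) ℕ.% n
%ℕ-%-divisor i m n = %ℕ-unique i n (i %ℕ (m ℕ.* n)) (i /ℕ (m ℕ.* n) * + m)
  (trans (a≡a%ℕn+[a/ℕn]*n i (m ℕ.* n)) (cong (_+_ (+ (i %ℕ (m ℕ.* n)))) (trans (cong (i /ℕ (m ℕ.* n) *_) (pos-* m n)) (sym (*-assoc (i /ℕ (m ℕ.* n)) (+ m) (+ n))))))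

%ℕ-+ : ∀ a b d .{{_ : ℕ.NonZero d}} → (a + b) %ℕ d ≡ (a %ℕ d ℕ.+ b %ℕ d) ℕ.% d
%ℕ-+ a b d = %ℕ-unique (a + b) d (a %ℕ d ℕ.+ b %ℕ d) (a /ℕ d + b /ℕ d) (begin
  a + b                                                      ≡⟨ cong₂ _+_ (a≡a%ℕn+[a/ℕn]*n a d) (a≡a%ℕn+[a/ℕn]*n b d) ⟩
  + (a %ℕ d) + a /ℕ d * + d + (+ (b %ℕ d) + b /ℕ d * + d)    ≡⟨ regroup (+ (a %ℕ d)) (+ (b %ℕ d)) (a /ℕ d) (b /ℕ d) (+ d) ⟩
  + (a %ℕ d) + + (b %ℕ d) + (a /ℕ d + b /ℕ d) * + d          ≡⟨ cong (λ t → t + (a /ℕ d + b /ℕ d) * + d) (pos-+ (a %ℕ d) (b %ℕ d)) ⟨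
  + (a %ℕ d ℕ.+ b %ℕ d) + (a /ℕ d + b /ℕ d) * + d            ∎)
  where
  open ≡-Reasoning
  regroup : ∀ x y k l d → x + k * d + (y + l * d) ≡ x + y + (k + l) * d
  regroup = solve-∀

OddResidue3or7 : ℕ → Set
OddResidue3or7 x = x ℕ.% 2 ≡ 1 → x ℕ.% 8 ≡ 3 ⊎ x ℕ.% 8 ≡ 7

oddResidue3or7? : ∀ x → Dec (OddResidue3or7 x)
oddResidue3or7? x = (x ℕ.% 2 ℕ.≟ 1) →-dec ((x ℕ.% 8 ℕ.≟ 3) ⊎-dec (x ℕ.% 8 ℕ.≟ 7))

type87-odd : All.All OddResidue3or7 type87
type87-odd = toWitness {a? = All.all? oddResidue3or7? type87} _

type811-odd : All.All OddResidue3or7 type811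
type811-odd = toWitness {a? = All.all? oddResidue3or7? type811} _

odd-curvature-3or7 : ∀ {r S} → All.All OddResidue3or7 S → HasResidues24 r S →
  ∀ c → IsCurvature r c → c %ℕ 2 ≡ 1 → c %ℕ 8 ≡ 3 ⊎ c %ℕ 8 ≡ 7
odd-curvature-3or7 {S = S} odd⇒3or7 residues c curvature c-odd =
  subst (λ t → t ≡ 3 ⊎ t ≡ 7) (sym (%ℕ-%-divisor c 3 8))
    (All.lookup odd⇒3or7 residue∈S (trans (sym (%ℕ-%-divisor c 12 2)) c-odd))
  where
  residue∈S : c %ℕ 24 ∈ S
  residue∈S = Equivalence.to (residues (c %ℕ 24)) (c , curvature , refl)

not-3-6-7 : ∀ {x n} → x ≡ + n → ¬ Residue367 n →
  ¬ (x %ℕ 8 ≡ 3) × ¬ (x %ℕ 8 ≡ 6) × ¬ (x %ℕ 8 ≡ 7)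
not-3-6-7 refl ¬bad = ¬bad ∘ here , ¬bad ∘ there ∘ here , ¬bad ∘ there ∘ there ∘ here

tangent-sum-mod8 : ∀ r → PrimitiveIntegralPacking r → ∀ a b → TangentPair r a b →
  ¬ ((a + b) %ℕ 8 ≡ 3) × ¬ ((a + b) %ℕ 8 ≡ 6) × ¬ ((a + b) %ℕ 8 ≡ 7)
tangent-sum-mod8 r packing a b tangent =
  let _ , a+b≡n , ¬bad = tangent-sum-not-residue367 r packing a b tangent in not-3-6-7 a+b≡n ¬bad

distinct-3-7 : ∀ a b → ¬ ((a + b) %ℕ 8 ≡ 6) → a %ℕ 8 ≡ 3 ⊎ a %ℕ 8 ≡ 7 → b %ℕ 8 ≡ 3 ⊎ b %ℕ 8 ≡ 7 →
  (a %ℕ 8 ≡ 3 × b %ℕ 8 ≡ 7) ⊎ (a %ℕ 8 ≡ 7 × b %ℕ 8 ≡ 3)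
distinct-3-7 a b ¬6 (inj₁ a3) (inj₁ b3) = contradiction (trans (%ℕ-+ a b 8) (cong₂ (λ s t → (s ℕ.+ t) ℕ.% 8) a3 b3)) ¬6
distinct-3-7 a b ¬6 (inj₁ a3) (inj₂ b7) = inj₁ (a3 , b7)
distinct-3-7 a b ¬6 (inj₂ a7) (inj₁ b3) = inj₂ (a7 , b3)
distinct-3-7 a b ¬6 (inj₂ a7) (inj₂ b7) = contradiction (trans (%ℕ-+ a b 8) (cong₂ (λ s t → (s ℕ.+ t) ℕ.% 8) a7 b7)) ¬6

proposition3p1 : (r : Quad) → PrimitiveIntegralPacking r →
    ((a b : ℤ) → TangentPair r a b →
      ¬ ((a + b) %ℕ 8 ≡ 3) × ¬ ((a + b) %ℕ 8 ≡ 6) × ¬ ((a + b) %ℕ 8 ≡ 7))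
    × ((HasResidues24 r type87 ⊎ HasResidues24 r type811) →
      (a b : ℤ) → TangentPair r a b → a %ℕ 2 ≡ 1 → b %ℕ 2 ≡ 1 →
      (a %ℕ 8 ≡ 3 × b %ℕ 8 ≡ 7) ⊎ (a %ℕ 8 ≡ 7 × b %ℕ 8 ≡ 3))
proposition3p1 r packing = tangent-sum-mod8 r packing , odd-pair
  where
  odd-pair : HasResidues24 r type87 ⊎ HasResidues24 r type811 → ∀ a b → TangentPair r a b →
    a %ℕ 2 ≡ 1 → b %ℕ 2 ≡ 1 → (a %ℕ 8 ≡ 3 × b %ℕ 8 ≡ 7) ⊎ (a %ℕ 8 ≡ 7 × b %ℕ 8 ≡ 3)
  odd-pair type a b tangent@(q , r⇝q , i , j , _ , qi≡a , qj≡b) a-odd b-odd =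
    distinct-3-7 a b (proj₁ (proj₂ (tangent-sum-mod8 r packing a b tangent)))
      (odd-class a (q , r⇝q , i , qi≡a) a-odd) (odd-class b (q , r⇝q , j , qj≡b) b-odd)
    where
    odd-class : ∀ c → IsCurvature r c → c %ℕ 2 ≡ 1 → c %ℕ 8 ≡ 3 ⊎ c %ℕ 8 ≡ 7
    odd-class = [ odd-curvature-3or7 type87-odd , odd-curvature-3or7 type811-odd ]′ type
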